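{- For every integer $r\geq 2$, \[ R_r(4)\leq \frac{(2r)!}{2^r}\left(\frac{10}{3}-\frac{2(r-2)}{(2r-1)(2r-3)}\right), \] and, asymptotically as $r\to\infty$, \[ R_r(4)\leq \frac{(2r)!}{2^r}\left(\frac{3+e}{2}\right)(1+o(1)). \]
   Context: For integers $r\geq 1$ and $k_1,\dots,k_r\geq 1$, the Ramsey number $R_r(k_1,\dots,k_r)$ is the minimum $N\in\mathbb{N}$ such that every coloring of the edges of the complete graph $K_N$ with $r$ colors $1,\dots,r$ contains, for some $i$, a complete subgraph on $k_i$ vertices all of whose edges have color $i$. The diagonal Ramsey number is $R_r(k)=R_r(k,\dots,k)$. Here $o(1)$ denotes a function tending to $0$ as $r\to\infty$. -}

module Defs where

open import Data.Nat as ℕ using (ℕ; zero; suc; _!; _^_)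
open import Data.Nat.Properties using (_!≢0; m^n≢0)
open import Data.Fin as Fin using (Fin)
open import Data.Integer using (+_)
open import Data.Rational using (ℚ; _/_; _+_; _*_; _-_; 0ℚ)
open import Data.Product using (Σ; ∃; _×_)
open import Function.Definitions using (Injective)
open import Relation.Binary.PropositionalEquality using (_≡_)
open import Relation.Nullary using (¬_)

-- An r-colouring of the edges of K_N (vertex set Fin N).  The colour of the
-- edge {u,v} with u < v is  c u v ; values c u v with u ≥ v are irrelevant.
Colouring : ℕ → ℕ → Set
Colouring r N = Fin N → Fin N → Fin r

MonoClique : ∀ {r N} → Colouring r N → ℕ → Fin r → Set
MonoClique {r} {N} c k i =
  Σ (Fin k → Fin N) λ f →
    Injective _≡_ _≡_ f × (∀ a b → f a Fin.< f b → c (f a) (f b) ≡ i)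

Arrows : (r : ℕ) → (Fin r → ℕ) → ℕ → Set
Arrows r ks N = ∀ (c : Colouring r N) → ∃ λ i → MonoClique c (ks i) i

IsRamseyNumber : (r : ℕ) → (Fin r → ℕ) → ℕ → Set
IsRamseyNumber r ks N = Arrows r ks N × (∀ M → M ℕ.< N → ¬ Arrows r ks M)

IsDiagRamsey : ℕ → ℕ → ℕ → Set
IsDiagRamsey r k N = IsRamseyNumber r (λ _ → k) N

toℚ : ℕ → ℚ
toℚ n = + n / 1

fact2r/2^r : ℕ → ℚ
fact2r/2^r r = (+ ((2 ℕ.* r) !) / (2 ^ r)) {{m^n≢0 2 r}}

-- (2r)!/2^r * (10/3 - 2(r-2)/((2r-1)(2r-3)))  for r = m + 2 ≥ 2
-- (here 2r-1 = 2m+3 and 2r-3 = 2m+1); value 0 for r < 2 (never used)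
bound : ℕ → ℚ
bound zero = 0ℚ
bound (suc zero) = 0ℚ
bound (suc (suc m)) =
  fact2r/2^r (suc (suc m))
    * (+ 10 / 3 - + (2 ℕ.* m) / (suc (suc (suc (2 ℕ.* m))) ℕ.* suc (2 ℕ.* m)))

-- partial sums of e = Σ_{k ≥ 0} 1/k! :  eSum n = Σ_{k < n} 1/k!
eSum : ℕ → ℚ
eSum zero = 0ℚ
eSum (suc n) = eSum n + (+ 1 / (n !)) {{n !≢0}}

{-# OPTIONS --safe #-}
-- A vertex v of an r-coloured K_N has, by pigeonhole, at least R(k₁,…,kᵢ − 1,…,k_r) neighbours
-- in some colour i, which gives R(k₁,…,k_r) ≤ 2 + Σᵢ (R(k₁,…,kᵢ − 1,…,k_r) − 1).  When every kᵢ
-- is 3 or 4 the right-hand side depends only on the numbers a of fours and b of threes, giving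
-- the bound B₄₃ a b + 1 ≥ R(4,…,4,3,…,3).  Along the recursion 2a + b drops by one and the
-- factor 2 lost by a four is paid for by 2^a, so (B₄₃ a b + 1)·2^a ≤ (p/q)·(2a + b)! propagates
-- from one layer 2a + b = L to all later ones.  Checking the layers L = 7 with p/q = 3 and
-- L = 13 with p/q = 17/6 by evaluation gives R_r(4) ≤ 3·(2r)!/2^r for r ≥ 4 and
-- R_r(4) ≤ (17/6)·(2r)!/2^r for r ≥ 7; it remains to note 3 ≤ 10/3 − 2(r−2)/((2r−1)(2r−3))
-- and 17/6 < (3+e)/2, while for r = 2, 3 the values B₄₃ r 0 + 1 = 20, 272 are compared directly.
module Submission where

open import Defs
open import Data.Nat as ℕ using (ℕ; zero; suc; pred; _+_; _*_; _^_; _!; s≤s; z≤n)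
import Data.Nat.Properties as ℕP
open import Data.Integer as ℤ using (+_)
import Data.Integer.Properties as ℤP
open import Data.Rational as ℚ using (ℚ; _/_; _≤_; _<_; 0ℚ; 1ℚ; ½; toℚᵘ)
import Data.Rational.Properties as ℚP
open import Data.Rational.Unnormalised as ℚᵘ using (mkℚᵘ; *≤*)
import Data.Rational.Unnormalised.Properties as ℚᵘP
open import Data.Fin as Fin using (Fin; zero; suc)
import Data.Fin.Properties as FinP
open import Data.Vec.Functional using (Vector; updateAt)
open import Data.Vec.Functional.Properties using (updateAt-updates; updateAt-minimal)
open import Data.Bool using (true; false; if_then_else_)
open import Data.List using (List; []; _∷_; length; lookup; filter; allFin)
open import Data.List.Properties using (length-tabulate)
open import Data.List.Relation.Unary.All as All using (All; []; _∷_)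
open import Data.List.Relation.Unary.AllPairs using (AllPairs; []; _∷_)
import Data.List.Relation.Unary.AllPairs.Properties as AllPairs
open import Data.List.Relation.Unary.Any using (here)
open import Data.List.Membership.Propositional using (_∈_)
open import Data.List.Membership.Propositional.Properties using (∈-lookup; ∈-filter⁻)
open import Data.List.Relation.Binary.Subset.Propositional using (_⊆_)
open import Data.List.Relation.Binary.Subset.Propositional.Properties
  using (filter-⊆; xs⊆x∷xs; ∷⁺ʳ; ⊆-trans)
open import Data.Product using (∃; _×_; _,_; proj₁; proj₂)
open import Data.Empty using (⊥-elim)
open import Function using (_∘_; id)
open import Function.Definitions using (Injective)
open import Relation.Binary using (tri<; tri≈; tri>)
open import Relation.Nullary using (Dec; does; yes; no)
open import Relation.Binary.PropositionalEquality
open import Algebra.Properties.Semiring.Sum ℕP.+-*-semiring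
  using (sum; sum-cong-≗; ∑-distrib-+; sum-replicate-zero; *-distribʳ-sum)
open import Data.Nat.Tactic.RingSolver using (solve-∀)
open import Algebra.Properties.CommutativeSemigroup ℕP.+-commutativeSemigroup using (x∙yz≈y∙xz)
import Algebra.Properties.CommutativeSemigroup ℕP.*-commutativeSemigroup as ℕ*

-- Finite sums and the pigeonhole principle

indicator : ∀ {p} {P : Set p} → Dec P → ℕ
indicator d = if does d then 1 else 0

sum-indicator-≡ : ∀ {r} (j : Fin r) → sum (λ i → indicator (j Fin.≟ i)) ≡ 1
sum-indicator-≡ {suc r} zero = cong suc (sum-replicate-zero r)
sum-indicator-≡ (suc j) = sum-indicator-≡ j

sum-updateAt : ∀ {a} {A : Set a} {r} (f : A → ℕ) (t : Vector A r) i (g : A → A) →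
  f (t i) + sum (f ∘ updateAt t i g) ≡ f (g (t i)) + sum (f ∘ t)
sum-updateAt f t zero g = x∙yz≈y∙xz (f (t zero)) (f (g (t zero))) _
sum-updateAt f t (suc i) g = begin
  f (t (suc i)) + (f (t zero) + sum (f ∘ updateAt (t ∘ suc) i g))
    ≡⟨ x∙yz≈y∙xz (f (t (suc i))) (f (t zero)) _ ⟩
  f (t zero) + (f (t (suc i)) + sum (f ∘ updateAt (t ∘ suc) i g))
    ≡⟨ cong (_+_ (f (t zero))) (sum-updateAt f (t ∘ suc) i g) ⟩
  f (t zero) + (f (g (t (suc i))) + sum (f ∘ t ∘ suc))
    ≡⟨ x∙yz≈y∙xz (f (t zero)) (f (g (t (suc i)))) _ ⟩
  f (g (t (suc i))) + (f (t zero) + sum (f ∘ t ∘ suc)) ∎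
  where open ≡-Reasoning

updateAt-pred-self : ∀ {r} (ks : Vector ℕ r) {i k} → ks i ≡ suc k → updateAt ks i pred i ≡ k
updateAt-pred-self ks {i} ksᵢ≡1+k = trans (updateAt-updates i ks) (cong pred ksᵢ≡1+k)

updateAt-pred-≤ : ∀ {r} (ks : Vector ℕ r) i j → updateAt ks i pred j ℕ.≤ ks j
updateAt-pred-≤ ks i j with i Fin.≟ j
... | yes refl = subst (ℕ._≤ ks i) (sym (updateAt-updates i ks)) ℕP.pred[n]≤n
... | no i≢j = ℕP.≤-reflexive (updateAt-minimal j i ks (i≢j ∘ sym))

sum<sum⇒∃< : ∀ {r} (m n : Vector ℕ r) → sum m ℕ.< sum n → ∃ λ i → m i ℕ.< n i
sum<sum⇒∃< {zero} m n ()
sum<sum⇒∃< {suc r} m n m<n with m zero ℕP.<? n zero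
... | yes m₀<n₀ = zero , m₀<n₀
... | no m₀≮n₀ with sum<sum⇒∃< (m ∘ suc) (n ∘ suc) tail<
  where
  tail< : sum (m ∘ suc) ℕ.< sum (n ∘ suc)
  tail< = ℕP.≰⇒> λ ≥ → ℕP.<⇒≱ m<n (ℕP.+-mono-≤ (ℕP.≮⇒≥ m₀≮n₀) ≥)
... | i , mᵢ<nᵢ = suc i , mᵢ<nᵢ

module _ {a} {A : Set a} {r : ℕ} (colour : A → Fin r) where

  colourClass : Fin r → List A → List A
  colourClass i = filter (λ x → colour x Fin.≟ i)

  length-colourClass-∷ : ∀ i x xs →
    length (colourClass i (x ∷ xs)) ≡ indicator (colour x Fin.≟ i) + length (colourClass i xs)
  length-colourClass-∷ i x xs with does (colour x Fin.≟ i)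
  ... | true = refl
  ... | false = refl

  sum-length-colourClass : ∀ xs → sum (λ i → length (colourClass i xs)) ≡ length xs
  sum-length-colourClass [] = sum-replicate-zero r
  sum-length-colourClass (x ∷ xs) = begin
    sum (λ i → length (colourClass i (x ∷ xs)))
      ≡⟨ sum-cong-≗ (λ i → length-colourClass-∷ i x xs) ⟩
    sum (λ i → indicator (colour x Fin.≟ i) + length (colourClass i xs))
      ≡⟨ ∑-distrib-+ (λ i → indicator (colour x Fin.≟ i)) (λ i → length (colourClass i xs)) ⟩
    sum (λ i → indicator (colour x Fin.≟ i)) + sum (λ i → length (colourClass i xs))
      ≡⟨ cong₂ _+_ (sum-indicator-≡ (colour x)) (sum-length-colourClass xs) ⟩
    suc (length xs) ∎
    where open ≡-Reasoning

  pigeonhole-colourClass : ∀ (m : Vector ℕ r) xs → sum m ℕ.< length xs →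
    ∃ λ i → m i ℕ.< length (colourClass i xs)
  pigeonhole-colourClass m xs h =
    sum<sum⇒∃< m _ (subst (sum m ℕ.<_) (sym (sum-length-colourClass xs)) h)

-- Monochromatic cliques in sorted vertex lists

AllPairs-lookup : ∀ {a ℓ} {A : Set a} {R : A → A → Set ℓ} {xs : List A} → AllPairs R xs →
  ∀ {i j} → i Fin.< j → R (lookup xs i) (lookup xs j)
AllPairs-lookup (Rx ∷ _) {zero} {suc j} _ = All.lookup Rx (∈-lookup j)
AllPairs-lookup (_ ∷ Rxs) {suc i} {suc j} (s≤s i<j) = AllPairs-lookup Rxs i<j

module _ {m n} {f : Fin m → Fin n} (mono : ∀ {a b} → a Fin.< b → f a Fin.< f b) where

  strictMono-injective : Injective _≡_ _≡_ f
  strictMono-injective {a} {b} fa≡fb with FinP.<-cmp a b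
  ... | tri< a<b _ _ = ⊥-elim (FinP.<-irrefl fa≡fb (mono a<b))
  ... | tri≈ _ a≡b _ = a≡b
  ... | tri> _ _ b<a = ⊥-elim (FinP.<-irrefl (sym fa≡fb) (mono b<a))

  strictMono-reflects-< : ∀ {a b} → f a Fin.< f b → a Fin.< b
  strictMono-reflects-< {a} {b} fa<fb with FinP.<-cmp a b
  ... | tri< a<b _ _ = a<b
  ... | tri≈ _ refl _ = ⊥-elim (FinP.<-irrefl refl fa<fb)
  ... | tri> _ _ b<a = ⊥-elim (FinP.<-asym fa<fb (mono b<a))

-- Vertex lists are kept increasing, so that c u w is only ever read with u < w, as in MonoClique.
module _ {r N : ℕ} (c : Colouring r N) where

  SortedClique : Fin r → List (Fin N) → Set
  SortedClique i = AllPairs (λ u w → u Fin.< w × c u w ≡ i)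

  CliqueIn : Fin r → ℕ → List (Fin N) → Set
  CliqueIn i k vs = ∃ λ ws → SortedClique i ws × length ws ≡ k × ws ⊆ vs

  cliqueIn-⊆ : ∀ {i k vs vs′} → vs ⊆ vs′ → CliqueIn i k vs → CliqueIn i k vs′
  cliqueIn-⊆ vs⊆vs′ (ws , clique , len , ws⊆vs) = ws , clique , len , ⊆-trans ws⊆vs vs⊆vs′

  cliqueIn-≤1 : ∀ {i k v vs} → k ℕ.≤ 1 → CliqueIn i k (v ∷ vs)
  cliqueIn-≤1 z≤n = [] , [] , refl , λ ()
  cliqueIn-≤1 {v = v} (s≤s z≤n) = v ∷ [] , [] ∷ [] , refl , λ { (here v≡w) → here v≡w }

  cliqueIn-∷ : ∀ {i k v vs} → All (v Fin.<_) vs →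
    CliqueIn i k (colourClass (c v) i vs) → CliqueIn i (suc k) (v ∷ vs)
  cliqueIn-∷ {i} {v = v} {vs} v<vs (ws , clique , len , ws⊆class) =
    v ∷ ws , All.tabulate joins ∷ clique , cong suc len , ∷⁺ʳ v (⊆-trans ws⊆class (filter-⊆ _ vs))
    where
    joins : ∀ {w} → w ∈ ws → v Fin.< w × c v w ≡ i
    joins w∈ws with ∈-filter⁻ (λ x → c v x Fin.≟ i) (ws⊆class w∈ws)
    ... | w∈vs , cvw≡i = All.lookup v<vs w∈vs , cvw≡i

  sortedClique⇒monoClique : ∀ {i ws} → SortedClique i ws → MonoClique c (length ws) i
  sortedClique⇒monoClique {i} {ws} clique =
    lookup ws , strictMono-injective increasing , λ a b fa<fb →
      proj₂ (AllPairs-lookup clique (strictMono-reflects-< increasing fa<fb))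
    where
    increasing : ∀ {a b} → a Fin.< b → lookup ws a Fin.< lookup ws b
    increasing a<b = proj₁ (AllPairs-lookup clique a<b)

SortedArrows : (r : ℕ) → Vector ℕ r → ℕ → Set
SortedArrows r ks n = ∀ {N} (c : Colouring r N) (vs : List (Fin N)) →
  AllPairs Fin._<_ vs → n ℕ.≤ length vs → ∃ λ i → CliqueIn c i (ks i) vs

sortedArrows-≤1 : ∀ {r} (ks : Vector ℕ r) i → ks i ℕ.≤ 1 → SortedArrows r ks 1
sortedArrows-≤1 ks i ksᵢ≤1 c (v ∷ vs) _ _ = i , cliqueIn-≤1 c ksᵢ≤1

sortedArrows-step : ∀ {r} (ks m : Vector ℕ r) →
  (∀ {i k} → ks i ≡ suc k → SortedArrows r (updateAt ks i pred) (suc (m i))) →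
  SortedArrows r ks (2 + sum m)
sortedArrows-step {r} ks m smaller {N} c (v ∷ vs) (v<vs ∷ sorted) (s≤s len) =
  let (i , large) = pigeonhole-colourClass (c v) m vs len in inColour i (ks i) refl large
  where
  class : Fin r → List (Fin N)
  class i = colourClass (c v) i vs

  inColour : ∀ i k → ks i ≡ k → m i ℕ.< length (class i) → ∃ λ j → CliqueIn c j (ks j) (v ∷ vs)
  inColour i zero ksᵢ≡0 _ = i , cliqueIn-≤1 c (subst (ℕ._≤ 1) (sym ksᵢ≡0) z≤n)
  inColour i (suc k) ksᵢ≡1+k large
    with smaller ksᵢ≡1+k c (class i) (AllPairs.filter⁺ (λ w → c v w Fin.≟ i) sorted) large
  ... | j , clique with i Fin.≟ j
  ...   | yes refl = i , subst (λ k → CliqueIn c i k (v ∷ vs)) (sym ksᵢ≡1+k)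
            (cliqueIn-∷ c v<vs
              (subst (λ k → CliqueIn c i k (class i)) (updateAt-pred-self ks ksᵢ≡1+k) clique))
  ...   | no i≢j = j , subst (λ k → CliqueIn c j k (v ∷ vs)) (updateAt-minimal j i ks (i≢j ∘ sym))
            (cliqueIn-⊆ c (⊆-trans (filter-⊆ _ vs) (xs⊆x∷xs vs v)) clique)

multiplicity : ∀ {r} → ℕ → Vector ℕ r → ℕ
multiplicity k ks = sum (λ i → indicator (ks i ℕ.≟ k))

multiplicity-updateAt-pred : ∀ {r} (ks : Vector ℕ r) {i k} → ks i ≡ suc k → ∀ j →
  indicator (suc k ℕ.≟ j) + multiplicity j (updateAt ks i pred)
    ≡ indicator (k ℕ.≟ j) + multiplicity j ks
multiplicity-updateAt-pred ks {i} ksᵢ≡1+k j =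
  subst (λ x → indicator (x ℕ.≟ j) + multiplicity j (updateAt ks i pred)
               ≡ indicator (pred x ℕ.≟ j) + multiplicity j ks) ksᵢ≡1+k
    (sum-updateAt (λ x → indicator (x ℕ.≟ j)) ks i pred)

-- Shifted by one (suc (B₄₃ a b) is the Ramsey bound) to keep truncated subtraction out of the recursion.
B₄₃ : ℕ → ℕ → ℕ
B₄₃ zero zero = 1
B₄₃ zero (suc b) = 1 + suc b * B₄₃ zero b
B₄₃ (suc a) zero = 1 + suc a * B₄₃ a 1
B₄₃ (suc a) (suc b) = 1 + suc a * B₄₃ a (suc (suc b)) + suc b * B₄₃ (suc a) b

B₄₃-unfold : ∀ a b → B₄₃ a b ≡ 1 + a * B₄₃ (pred a) (suc b) + b * B₄₃ a (pred b)
B₄₃-unfold zero zero = refl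
B₄₃-unfold zero (suc b) = refl
B₄₃-unfold (suc a) zero = sym (ℕP.+-identityʳ _)
B₄₃-unfold (suc a) (suc b) = refl

B₄₃-ind : ∀ {ℓ} (P : ℕ → ℕ → Set ℓ) →
  (∀ a b → (1 ℕ.≤ a → P (pred a) (suc b)) → (1 ℕ.≤ b → P a (pred b)) → P a b) →
  ∀ a b → P a b
B₄₃-ind P step zero zero = step zero zero (λ ()) (λ ())
B₄₃-ind P step zero (suc b) = step zero (suc b) (λ ()) (λ _ → B₄₃-ind P step zero b)
B₄₃-ind P step (suc a) zero = step (suc a) zero (λ _ → B₄₃-ind P step a 1) (λ ())
B₄₃-ind P step (suc a) (suc b) =
  step (suc a) (suc b) (λ _ → B₄₃-ind P step a (suc (suc b))) (λ _ → B₄₃-ind P step (suc a) b)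

weight₄₃ : ℕ → ℕ → ℕ → ℕ
weight₄₃ X Y 3 = Y
weight₄₃ X Y 4 = X
weight₄₃ X Y _ = 0

sum-weight₄₃ : ∀ {r} X Y (ks : Vector ℕ r) →
  sum (weight₄₃ X Y ∘ ks) ≡ multiplicity 4 ks * X + multiplicity 3 ks * Y
sum-weight₄₃ X Y ks = begin
  sum (weight₄₃ X Y ∘ ks)
    ≡⟨ sum-cong-≗ (split ∘ ks) ⟩
  sum (λ i → indicator (ks i ℕ.≟ 4) * X + indicator (ks i ℕ.≟ 3) * Y)
    ≡⟨ ∑-distrib-+ (λ i → indicator (ks i ℕ.≟ 4) * X) (λ i → indicator (ks i ℕ.≟ 3) * Y) ⟩
  sum (λ i → indicator (ks i ℕ.≟ 4) * X) + sum (λ i → indicator (ks i ℕ.≟ 3) * Y)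
    ≡⟨ cong₂ _+_ (*-distribʳ-sum X (λ i → indicator (ks i ℕ.≟ 4)))
                 (*-distribʳ-sum Y (λ i → indicator (ks i ℕ.≟ 3))) ⟨
  multiplicity 4 ks * X + multiplicity 3 ks * Y ∎
  where
  open ≡-Reasoning
  split : ∀ k → weight₄₃ X Y k ≡ indicator (k ℕ.≟ 4) * X + indicator (k ℕ.≟ 3) * Y
  split 0 = refl
  split 1 = refl
  split 2 = refl
  split 3 = sym (ℕP.+-identityʳ Y)
  split 4 = sym (trans (ℕP.+-identityʳ _) (ℕP.+-identityʳ X))
  split (suc (suc (suc (suc (suc k))))) = refl

Arrows₄₃ : ℕ → ℕ → Set
Arrows₄₃ a b = ∀ {r} (ks : Vector ℕ r) → (∀ i → ks i ℕ.≤ 4) →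
  multiplicity 4 ks ≡ a → multiplicity 3 ks ≡ b → SortedArrows r ks (suc (B₄₃ a b))

sortedArrows-B₄₃ : ∀ a b → Arrows₄₃ a b
sortedArrows-B₄₃ = B₄₃-ind Arrows₄₃ step
  where
  step : ∀ a b → (1 ℕ.≤ a → Arrows₄₃ (pred a) (suc b)) → (1 ℕ.≤ b → Arrows₄₃ a (pred b)) →
    Arrows₄₃ a b
  step a b fewer4 fewer3 {r} ks ks≤4 refl refl =
    subst (SortedArrows r ks) (cong suc total) (sortedArrows-step ks (weight₄₃ X Y ∘ ks) smaller)
    where
    X Y : ℕ
    X = B₄₃ (pred a) (suc b)
    Y = B₄₃ a (pred b)

    total : suc (sum (weight₄₃ X Y ∘ ks)) ≡ B₄₃ a b
    total = trans (cong suc (sum-weight₄₃ X Y ks)) (sym (B₄₃-unfold a b))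

    stillBounded : ∀ i j → updateAt ks i pred j ℕ.≤ 4
    stillBounded i j = ℕP.≤-trans (updateAt-pred-≤ ks i j) (ks≤4 j)

    decrement : ∀ i k → ks i ≡ suc k →
      SortedArrows r (updateAt ks i pred) (suc (weight₄₃ X Y (suc k)))
    decrement i 0 ksᵢ≡1 =
      sortedArrows-≤1 _ i (subst (ℕ._≤ 1) (sym (updateAt-pred-self ks ksᵢ≡1)) z≤n)
    decrement i 1 ksᵢ≡2 =
      sortedArrows-≤1 _ i (subst (ℕ._≤ 1) (sym (updateAt-pred-self ks ksᵢ≡2)) (s≤s z≤n))
    decrement i 2 ksᵢ≡3 =
      fewer3 (subst (1 ℕ.≤_) threes (s≤s z≤n)) _ (stillBounded i)
        (multiplicity-updateAt-pred ks ksᵢ≡3 4) (cong pred threes)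
      where
      threes : suc (multiplicity 3 (updateAt ks i pred)) ≡ multiplicity 3 ks
      threes = multiplicity-updateAt-pred ks ksᵢ≡3 3
    decrement i 3 ksᵢ≡4 =
      fewer4 (subst (1 ℕ.≤_) fours (s≤s z≤n)) _ (stillBounded i)
        (cong pred fours) (multiplicity-updateAt-pred ks ksᵢ≡4 3)
      where
      fours : suc (multiplicity 4 (updateAt ks i pred)) ≡ multiplicity 4 ks
      fours = multiplicity-updateAt-pred ks ksᵢ≡4 4
    decrement i (suc (suc (suc (suc k)))) ksᵢ≡5+k =
      ⊥-elim (ℕP.<⇒≱ (ℕP.m≤m+n 5 k) (subst (ℕ._≤ 4) ksᵢ≡5+k (ks≤4 i)))

    smaller : ∀ {i k} → ks i ≡ suc k →
      SortedArrows r (updateAt ks i pred) (suc (weight₄₃ X Y (ks i)))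
    smaller {i} {k} ksᵢ≡1+k =
      subst (λ x → SortedArrows r (updateAt ks i pred) (suc (weight₄₃ X Y x)))
        (sym ksᵢ≡1+k) (decrement i k ksᵢ≡1+k)

sum-ones : ∀ r → sum {r} (λ _ → 1) ≡ r
sum-ones zero = refl
sum-ones (suc r) = cong suc (sum-ones r)

arrows-B₄₃ : ∀ r → Arrows r (λ _ → 4) (suc (B₄₃ r 0))
arrows-B₄₃ r c =
  let (i , ws , clique , len , _) =
        sortedArrows-B₄₃ r 0 (λ _ → 4) (λ _ → ℕP.≤-refl) (sum-ones r) (sum-replicate-zero r)
          c (allFin (suc (B₄₃ r 0))) (AllPairs.tabulate⁺-< id)
          (ℕP.≤-reflexive (sym (length-tabulate id)))
  in i , subst (λ k → MonoClique c k i) len (sortedClique⇒monoClique c clique)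

R₄-≤-B₄₃ : ∀ {r N} → IsDiagRamsey r 4 N → N ℕ.≤ suc (B₄₃ r 0)
R₄-≤-B₄₃ {r} (_ , minimal) = ℕP.≮⇒≥ λ N>B → minimal (suc (B₄₃ r 0)) N>B (arrows-B₄₃ r)

-- Growth of B₄₃

LayerBound : ℕ → ℕ → ℕ → Set
LayerBound p q n = ∀ a b → 2 * a + b ≡ n → suc (B₄₃ a b) * (2 ^ a * q) ℕ.≤ p * n !

*-suc-+-*-suc : ∀ a b x y → a * suc x + b * suc y ≡ a + b + a * x + b * y
*-suc-+-*-suc = solve-∀

regroup-doubling : ∀ a x t q → suc a * x * (2 * t * q) ≡ 2 * suc a * (x * (t * q))
regroup-doubling = solve-∀

2[1+a]+b≡1+[2a+[1+b]] : ∀ a b → 2 * suc a + b ≡ suc (2 * a + suc b)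
2[1+a]+b≡1+[2a+[1+b]] = solve-∀

4≤2a+b⇒2≤a+b : ∀ {a b} → 4 ℕ.≤ 2 * a + b → 2 ℕ.≤ a + b
4≤2a+b⇒2≤a+b {a} {b} 4≤2a+b = ℕP.*-cancelˡ-≤ 2 (begin
  4               ≤⟨ 4≤2a+b ⟩
  2 * a + b       ≤⟨ ℕP.+-monoʳ-≤ (2 * a) (ℕP.m≤n+m b b) ⟩
  2 * a + (b + b) ≡⟨ cong (_+_ (2 * a)) (cong (_+_ b) (ℕP.+-identityʳ b)) ⟨
  2 * a + 2 * b   ≡⟨ ℕP.*-distribˡ-+ 2 a b ⟨
  2 * (a + b)     ∎)
  where open ℕP.≤-Reasoning

layer-suc : ∀ {p q n} → 3 ℕ.≤ n → LayerBound p q n → LayerBound p q (suc n)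
layer-suc {p} {q} {n} 3≤n layer a b 2a+b≡1+n = begin
  suc (B₄₃ a b) * c                    ≡⟨ cong (λ z → suc z * c) (B₄₃-unfold a b) ⟩
  (2 + a * X + b * Y) * c              ≤⟨ ℕP.*-monoˡ-≤ c (ℕP.+-monoˡ-≤ (b * Y) (ℕP.+-monoˡ-≤ (a * X) 2≤a+b)) ⟩
  (a + b + a * X + b * Y) * c          ≡⟨ cong (_* c) (*-suc-+-*-suc a b X Y) ⟨
  (a * suc X + b * suc Y) * c          ≡⟨ ℕP.*-distribʳ-+ c (a * suc X) (b * suc Y) ⟩
  a * suc X * c + b * suc Y * c        ≤⟨ ℕP.+-mono-≤ (fours a 2a+b≡1+n) (threes b 2a+b≡1+n) ⟩
  2 * a * (p * n !) + b * (p * n !)    ≡⟨ ℕP.*-distribʳ-+ (p * n !) (2 * a) b ⟨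
  (2 * a + b) * (p * n !)              ≡⟨ cong (_* (p * n !)) 2a+b≡1+n ⟩
  suc n * (p * n !)                    ≡⟨ ℕ*.x∙yz≈y∙xz (suc n) p (n !) ⟩
  p * suc n ! ∎
  where
  open ℕP.≤-Reasoning
  c X Y : ℕ
  c = 2 ^ a * q
  X = B₄₃ (pred a) (suc b)
  Y = B₄₃ a (pred b)

  2≤a+b : 2 ℕ.≤ a + b
  2≤a+b = 4≤2a+b⇒2≤a+b {a} {b} (ℕP.≤-trans (s≤s 3≤n) (ℕP.≤-reflexive (sym 2a+b≡1+n)))

  fours : ∀ a → 2 * a + b ≡ suc n →
    a * suc (B₄₃ (pred a) (suc b)) * (2 ^ a * q) ℕ.≤ 2 * a * (p * n !)
  fours zero _ = z≤n
  fours (suc a) 2a+b≡1+n = begin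
    suc a * suc (B₄₃ a (suc b)) * (2 * 2 ^ a * q)
      ≡⟨ regroup-doubling a (suc (B₄₃ a (suc b))) (2 ^ a) q ⟩
    2 * suc a * (suc (B₄₃ a (suc b)) * (2 ^ a * q))
      ≤⟨ ℕP.*-monoʳ-≤ (2 * suc a) (layer a (suc b)
           (ℕP.suc-injective (trans (sym (2[1+a]+b≡1+[2a+[1+b]] a b)) 2a+b≡1+n))) ⟩
    2 * suc a * (p * n !) ∎

  threes : ∀ b → 2 * a + b ≡ suc n → b * suc (B₄₃ a (pred b)) * c ℕ.≤ b * (p * n !)
  threes zero _ = z≤n
  threes (suc b) 2a+b≡1+n = begin
    suc b * suc (B₄₃ a b) * c   ≡⟨ ℕP.*-assoc (suc b) (suc (B₄₃ a b)) c ⟩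
    suc b * (suc (B₄₃ a b) * c) ≤⟨ ℕP.*-monoʳ-≤ (suc b) (layer a b
                                     (ℕP.suc-injective (trans (sym (ℕP.+-suc (2 * a) b)) 2a+b≡1+n))) ⟩
    suc b * (p * n !) ∎

layer-+ : ∀ {p q L} → 3 ℕ.≤ L → LayerBound p q L → ∀ d → LayerBound p q (d + L)
layer-+ 3≤L layer zero = layer
layer-+ {p} {q} {L} 3≤L layer (suc d) =
  layer-suc {p} {q} (ℕP.≤-trans 3≤L (ℕP.m≤n+m L d)) (layer-+ {p} {q} 3≤L layer d)

diagonal-bound : ∀ {p q L} → 3 ℕ.≤ L → LayerBound p q L →
  ∀ r → L ℕ.≤ 2 * r → suc (B₄₃ r 0) * (2 ^ r * q) ℕ.≤ p * (2 * r) !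
diagonal-bound {p} {q} {L} 3≤L layer r L≤2r =
  subst (LayerBound p q) (ℕP.m∸n+n≡m L≤2r) (layer-+ {p} {q} 3≤L layer (2 * r ℕ.∸ L))
    r 0 (ℕP.+-identityʳ (2 * r))

2k≤2[k+a]+b : ∀ k a b → 2 * k ℕ.≤ 2 * (k + a) + b
2k≤2[k+a]+b k a b = ℕP.≤-trans (ℕP.*-monoʳ-≤ 2 (ℕP.m≤m+n k a)) (ℕP.m≤m+n _ b)

layer₇ : LayerBound 3 1 7
layer₇ 0 .7 refl = ℕP.≤ᵇ⇒≤ _ _ _
layer₇ 1 .5 refl = ℕP.≤ᵇ⇒≤ _ _ _
layer₇ 2 .3 refl = ℕP.≤ᵇ⇒≤ _ _ _
layer₇ 3 .1 refl = ℕP.≤ᵇ⇒≤ _ _ _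
layer₇ (suc (suc (suc (suc a)))) b 2a+b≡7 =
  ⊥-elim (ℕP.1+n≰n (subst (8 ℕ.≤_) 2a+b≡7 (2k≤2[k+a]+b 4 a b)))

layer₁₃ : LayerBound 17 6 13
layer₁₃ 0 .13 refl = ℕP.≤ᵇ⇒≤ _ _ _
layer₁₃ 1 .11 refl = ℕP.≤ᵇ⇒≤ _ _ _
layer₁₃ 2 .9 refl = ℕP.≤ᵇ⇒≤ _ _ _
layer₁₃ 3 .7 refl = ℕP.≤ᵇ⇒≤ _ _ _
layer₁₃ 4 .5 refl = ℕP.≤ᵇ⇒≤ _ _ _
layer₁₃ 5 .3 refl = ℕP.≤ᵇ⇒≤ _ _ _
layer₁₃ 6 .1 refl = ℕP.≤ᵇ⇒≤ _ _ _
layer₁₃ (suc (suc (suc (suc (suc (suc (suc a))))))) b 2a+b≡13 =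
  ⊥-elim (ℕP.1+n≰n (subst (14 ℕ.≤_) 2a+b≡13 (2k≤2[k+a]+b 7 a b)))

-- Rational bounds

/-mono-≤ : ∀ m b n d .{{_ : ℕ.NonZero b}} .{{_ : ℕ.NonZero d}} →
  m * d ℕ.≤ n * b → + m / b ≤ + n / d
/-mono-≤ m zero n d {{b≢0}} = ⊥-elim (ℕ.≢-nonZero⁻¹ zero {{b≢0}} refl)
/-mono-≤ m b n zero {{_}} {{d≢0}} = ⊥-elim (ℕ.≢-nonZero⁻¹ zero {{d≢0}} refl)
/-mono-≤ m (suc b) n (suc d) md≤nb = ℚP.toℚᵘ-cancel-≤ (begin
  toℚᵘ (+ m / suc b)    ≃⟨ ℚP.toℚᵘ-fromℚᵘ (mkℚᵘ (+ m) b) ⟩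
  mkℚᵘ (+ m) b          ≤⟨ *≤* (subst₂ ℤ._≤_ (ℤP.pos-* m (suc d)) (ℤP.pos-* n (suc b))
                                (ℤ.+≤+ md≤nb)) ⟩
  mkℚᵘ (+ n) d          ≃⟨ ℚP.toℚᵘ-fromℚᵘ (mkℚᵘ (+ n) d) ⟨
  toℚᵘ (+ n / suc d)    ∎)
  where open ℚᵘP.≤-Reasoning

/-*-/ : ∀ m b n d .{{_ : ℕ.NonZero b}} .{{_ : ℕ.NonZero d}} →
  (+ m / b) ℚ.* (+ n / d) ≡ (+ (m * n) / (b * d)) {{ℕP.m*n≢0 b d}}
/-*-/ m zero n d {{b≢0}} = ⊥-elim (ℕ.≢-nonZero⁻¹ zero {{b≢0}} refl)
/-*-/ m b n zero {{_}} {{d≢0}} = ⊥-elim (ℕ.≢-nonZero⁻¹ zero {{d≢0}} refl)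
/-*-/ m (suc b) n (suc d) = ℚP.toℚᵘ-injective (begin
  toℚᵘ ((+ m / suc b) ℚ.* (+ n / suc d))        ≈⟨ ℚP.toℚᵘ-homo-* (+ m / suc b) (+ n / suc d) ⟩
  toℚᵘ (+ m / suc b) ℚᵘ.* toℚᵘ (+ n / suc d)
    ≈⟨ ℚᵘP.*-cong (ℚP.toℚᵘ-fromℚᵘ (mkℚᵘ (+ m) b)) (ℚP.toℚᵘ-fromℚᵘ (mkℚᵘ (+ n) d)) ⟩
  mkℚᵘ (+ m) b ℚᵘ.* mkℚᵘ (+ n) d               ≡⟨ cong (λ k → mkℚᵘ k _) (ℤP.pos-* m n) ⟨
  mkℚᵘ (+ (m * n)) (pred (suc b * suc d))       ≈⟨ ℚP.toℚᵘ-fromℚᵘ _ ⟨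
  toℚᵘ (+ (m * n) / (suc b * suc d))            ∎)
  where open ℚᵘP.≃-Reasoning

toℚ-≤-fraction : ∀ r N p q .{{_ : ℕ.NonZero q}} → N * (2 ^ r * q) ℕ.≤ p * (2 * r) ! →
  toℚ N ≤ fact2r/2^r r ℚ.* (+ p / q)
toℚ-≤-fraction r N p q N2ʳq≤p[2r]! =
  subst (toℚ N ≤_) (sym (/-*-/ ((2 * r) !) (2 ^ r) p q))
    (/-mono-≤ N 1 ((2 * r) ! * p) (2 ^ r * q) (ℕP.≤-trans N2ʳq≤p[2r]!
      (ℕP.≤-reflexive (trans (ℕP.*-comm p ((2 * r) !)) (sym (ℕP.*-identityʳ _))))))
  where
  instance
    2ʳ≢0 : ℕ.NonZero (2 ^ r)
    2ʳ≢0 = ℕP.m^n≢0 2 r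
    2ʳq≢0 : ℕ.NonZero (2 ^ r * q)
    2ʳq≢0 = ℕP.m*n≢0 (2 ^ r) q

toℚ-R₄-≤-B₄₃ : ∀ {r N} → IsDiagRamsey r 4 N → toℚ N ≤ toℚ (suc (B₄₃ r 0))
toℚ-R₄-≤-B₄₃ {r} {N} isR₄ = /-mono-≤ N 1 (suc (B₄₃ r 0)) 1 (ℕP.*-monoˡ-≤ 1 (R₄-≤-B₄₃ isR₄))

R₄-≤-fraction : ∀ p q {L} .{{_ : ℕ.NonZero q}} → 3 ℕ.≤ L → LayerBound p q L →
  ∀ r N → L ℕ.≤ 2 * r → IsDiagRamsey r 4 N → toℚ N ≤ fact2r/2^r r ℚ.* (+ p / q)
R₄-≤-fraction p q 3≤L layer r N L≤2r isR₄ = toℚ-≤-fraction r N p q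
  (ℕP.≤-trans (ℕP.*-monoˡ-≤ (2 ^ r * q) (R₄-≤-B₄₃ isR₄))
    (diagonal-bound {p} {q} 3≤L layer r L≤2r))

3≤bound-factor : ∀ m → + 3 / 1 ≤ + 10 / 3 ℚ.- + (2 * m) / (suc (suc (suc (2 * m))) * suc (2 * m))
3≤bound-factor m = ℚP.+-monoʳ-≤ (+ 10 / 3) (ℚP.neg-antimono-≤ (/-mono-≤ (2 * m) D 1 3 (begin
  2 * m * 3   ≡⟨ ℕP.*-comm (2 * m) 3 ⟩
  3 * (2 * m) ≤⟨ ℕP.*-mono-≤ (ℕP.m≤m+n 3 (2 * m)) (ℕP.n≤1+n (2 * m)) ⟩
  D           ≡⟨ ℕP.*-identityˡ D ⟨
  1 * D       ∎)))
  where
  open ℕP.≤-Reasoning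
  D : ℕ
  D = suc (suc (suc (2 * m))) * suc (2 * m)

fact2r/2^r-nonNeg : ∀ r → ℚ.NonNegative (fact2r/2^r r)
fact2r/2^r-nonNeg r = ℚP.normalize-nonNeg ((2 * r) !) (2 ^ r) {{ℕP.m^n≢0 2 r}}

≤-*-1+ε : ∀ p .{{_ : ℚ.NonNegative p}} {ε} → 0ℚ < ε → p ≤ p ℚ.* (1ℚ ℚ.+ ε)
≤-*-1+ε p ε>0 = subst (_≤ p ℚ.* _) (ℚP.*-identityʳ p)
  (ℚP.*-monoˡ-≤-nonNeg p (ℚP.+-monoʳ-≤ 1ℚ (ℚP.<⇒≤ ε>0)))

R₄-≤-bound : (r : ℕ) → 2 ℕ.≤ r → (N : ℕ) → IsDiagRamsey r 4 N → toℚ N ≤ bound r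
R₄-≤-bound 0 () N isR₄
R₄-≤-bound 1 (s≤s ()) N isR₄
R₄-≤-bound 2 _ N isR₄ = ℚP.≤-trans (toℚ-R₄-≤-B₄₃ isR₄) (ℚP.≤ᵇ⇒≤ _)
R₄-≤-bound 3 _ N isR₄ = ℚP.≤-trans (toℚ-R₄-≤-B₄₃ isR₄) (ℚP.≤ᵇ⇒≤ _)
R₄-≤-bound (suc (suc (suc (suc m)))) _ N isR₄ =
  ℚP.≤-trans (R₄-≤-fraction 3 1 (s≤s (s≤s (s≤s z≤n))) layer₇ (4 + m) N 7≤2r isR₄)
    (ℚP.*-monoˡ-≤-nonNeg (fact2r/2^r (4 + m)) {{fact2r/2^r-nonNeg (4 + m)}}
      (3≤bound-factor (2 + m)))
  where
  7≤2r : 7 ℕ.≤ 2 * (4 + m)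
  7≤2r = ℕP.≤-trans (ℕP.n≤1+n 7) (ℕP.*-monoʳ-≤ 2 (ℕP.m≤m+n 4 m))

-- (3 + eSum 4)/2 = 17/6 < (3 + e)/2, so n = 4 serves for every ε.
R₄-≤-asymptotic : (ε : ℚ) → 0ℚ < ε → ∃ λ r₀ → (r : ℕ) → r₀ ℕ.≤ r → (N : ℕ) → IsDiagRamsey r 4 N →
  ∃ λ n → toℚ N ≤ fact2r/2^r r ℚ.* ((toℚ 3 ℚ.+ eSum n) ℚ.* ½) ℚ.* (1ℚ ℚ.+ ε)
R₄-≤-asymptotic ε ε>0 = 7 , λ r 7≤r N isR₄ → 4 ,
  ℚP.≤-trans (R₄-≤-fraction 17 6 (s≤s (s≤s (s≤s z≤n))) layer₁₃ r N (13≤2r 7≤r) isR₄)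
    (≤-*-1+ε (fact2r/2^r r ℚ.* (+ 17 / 6))
      {{ℚP.nonNeg*nonNeg⇒nonNeg (fact2r/2^r r) {{fact2r/2^r-nonNeg r}} (+ 17 / 6)}} ε>0)
  where
  13≤2r : ∀ {r} → 7 ℕ.≤ r → 13 ℕ.≤ 2 * r
  13≤2r 7≤r = ℕP.≤-trans (ℕP.n≤1+n 13) (ℕP.*-monoʳ-≤ 2 7≤r)

theorem1p3 :
    ((r : ℕ) → 2 ℕ.≤ r → (N : ℕ) → IsDiagRamsey r 4 N → toℚ N ≤ bound r)
    ×
    ((ε : ℚ) → 0ℚ < ε → ∃ λ r₀ → (r : ℕ) → r₀ ℕ.≤ r → (N : ℕ) → IsDiagRamsey r 4 N →
      ∃ λ n → toℚ N ≤ fact2r/2^r r ℚ.* ((toℚ 3 ℚ.+ eSum n) ℚ.* ½) ℚ.* (1ℚ ℚ.+ ε))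
theorem1p3 = R₄-≤-bound , R₄-≤-asymptotic
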